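{- Let $C_1(x,y,z)=x^2+y^2+z^2-1-2xyz$. Suppose $(a,b,c)$ is a solution in positive integers of $C_1(a,b,c)=0$ with $b\geq\max\{a,c\}$ and $1<\min\{a,c\}$. Then \[ b=ac+\sqrt{(a^2-1)(c^2-1)},\qquad a=bc-\sqrt{(b^2-1)(c^2-1)},\qquad c=ab-\sqrt{(a^2-1)(b^2-1)}. \]
   Context: $C_1$ is Cayley's cubic $C_s(x,y,z)=s(x^2+y^2+z^2)-s^3-2xyz$ with $s=1$. -}

module Defs where

open import Data.Integer using (ℤ; +_; _+_; _*_; _-_; _≤_)
open import Data.Product using (_×_)
open import Relation.Binary.PropositionalEquality using (_≡_)

Cs : ℤ → ℤ → ℤ → ℤ → ℤ
Cs s x y z = s * (x * x + y * y + z * z) - s * s * s - + 2 * x * y * z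

C₁ : ℤ → ℤ → ℤ → ℤ
C₁ = Cs (+ 1)

IsSqrt : ℤ → ℤ → Set
IsSqrt r n = (+ 0 ≤ r) × (r * r ≡ n)

{-# OPTIONS --safe #-}
module Submission where

-- As a quadratic in b, the equation C₁(a,b,c) = 0 reads (b - ac)² = (a² - 1)(c² - 1), so b is one of the
-- two roots ac ± √((a² - 1)(c² - 1)); the same holds for a and c with the roles of the variables permuted.
-- Since b is the largest entry and the others are at least 2, bc ≥ a and ab ≥ c, which fixes the signs
-- for a and c. For b, the smaller root is impossible: b < ac would give b(b + 1) ≤ abc, and with
-- a² + c² ≤ abc this contradicts a² + b² + c² = 1 + 2abc.

open import Defs
open import Data.Integer using (ℤ; +_; _+_; _*_; _-_; _≤_; _<_; -[1+_]; +≤+; +<+)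
open import Data.Integer.Properties using (pos-+; pos-*; +-injective; i-j≡0⇒i≡j; i≡j⇒i-j≡0; i≤j⇒0≤j-i)
import Data.Integer.Tactic.RingSolver as ℤ-Solver
import Data.Nat.Base as ℕ
import Data.Nat.Properties as ℕ
import Data.Nat.Tactic.RingSolver as ℕ-Solver
open import Data.List.Base using (_∷_; [])
open import Data.Product using (_×_; ∃-syntax; _,_)
open import Relation.Binary.PropositionalEquality using (_≡_; refl; sym; trans; cong; cong₂; subst)
open import Relation.Nullary using (yes; no)
open import Data.Empty using (⊥-elim)

sum-of-squares≤product : ∀ {a b c} → 2 ℕ.≤ a → 2 ℕ.≤ c → a ℕ.≤ b → c ℕ.≤ b →
  a ℕ.* a ℕ.+ c ℕ.* c ℕ.≤ a ℕ.* b ℕ.* c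
sum-of-squares≤product {a} {b} {c} 2≤a 2≤c a≤b c≤b = ℕ.*-cancelˡ-≤ 2 (begin
  2 ℕ.* (a ℕ.* a ℕ.+ c ℕ.* c)       ≡⟨ ℕ-Solver.solve (a ∷ c ∷ []) ⟩
  a ℕ.* a ℕ.* 2 ℕ.+ c ℕ.* c ℕ.* 2   ≤⟨ ℕ.+-mono-≤ (ℕ.*-monoʳ-≤ (a ℕ.* a) 2≤c) (ℕ.*-monoʳ-≤ (c ℕ.* c) 2≤a) ⟩
  a ℕ.* a ℕ.* c ℕ.+ c ℕ.* c ℕ.* a   ≤⟨ ℕ.+-mono-≤ (ℕ.*-monoˡ-≤ c (ℕ.*-monoʳ-≤ a a≤b))
                                                   (ℕ.*-monoˡ-≤ a (ℕ.*-monoˡ-≤ c c≤b)) ⟩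
  a ℕ.* b ℕ.* c ℕ.+ b ℕ.* c ℕ.* a   ≡⟨ ℕ-Solver.solve (a ∷ b ∷ c ∷ []) ⟩
  2 ℕ.* (a ℕ.* b ℕ.* c)             ∎)
  where open ℕ.≤-Reasoning

product≤middle : ∀ {a b c} → 2 ℕ.≤ a → 2 ℕ.≤ c → a ℕ.≤ b → c ℕ.≤ b →
  a ℕ.* a ℕ.+ b ℕ.* b ℕ.+ c ℕ.* c ≡ 1 ℕ.+ 2 ℕ.* (a ℕ.* b ℕ.* c) →
  a ℕ.* c ℕ.≤ b
product≤middle {a} {b} {c} 2≤a 2≤c a≤b c≤b cubic with a ℕ.* c ℕ.≤? b
... | yes ac≤b = ac≤b
... | no ac≰b = ⊥-elim (ℕ.<-irrefl refl abc<abc)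
  where
  open ℕ.≤-Reasoning
  abc<abc : 2 ℕ.* (a ℕ.* b ℕ.* c) ℕ.< 2 ℕ.* (a ℕ.* b ℕ.* c)
  abc<abc = begin-strict
    2 ℕ.* (a ℕ.* b ℕ.* c)                     <⟨ ℕ.n<1+n _ ⟩
    1 ℕ.+ 2 ℕ.* (a ℕ.* b ℕ.* c)               ≡⟨ sym cubic ⟩
    a ℕ.* a ℕ.+ b ℕ.* b ℕ.+ c ℕ.* c           ≤⟨ ℕ.m≤m+n _ b ⟩
    a ℕ.* a ℕ.+ b ℕ.* b ℕ.+ c ℕ.* c ℕ.+ b     ≡⟨ ℕ-Solver.solve (a ∷ b ∷ c ∷ []) ⟩
    (a ℕ.* a ℕ.+ c ℕ.* c) ℕ.+ b ℕ.* ℕ.suc b   ≤⟨ ℕ.+-mono-≤ (sum-of-squares≤product 2≤a 2≤c a≤b c≤b)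
                                                          (ℕ.*-monoʳ-≤ b (ℕ.≰⇒> ac≰b)) ⟩
    a ℕ.* b ℕ.* c ℕ.+ b ℕ.* (a ℕ.* c)         ≡⟨ ℕ-Solver.solve (a ∷ b ∷ c ∷ []) ⟩
    2 ℕ.* (a ℕ.* b ℕ.* c)                     ∎

C₁≡0⇒cubic : ∀ x y z → C₁ x y z ≡ + 0 → x * x + y * y + z * z ≡ + 1 + + 2 * (x * y * z)
C₁≡0⇒cubic x y z C₁≡0 = i-j≡0⇒i≡j _ _ (trans (C₁-as-difference x y z) C₁≡0)
  where
  -- The right-hand side is C₁ x y z unfolded: the ring solver does not unfold definitions.
  C₁-as-difference : ∀ x y z →
    (x * x + y * y + z * z) - (+ 1 + + 2 * (x * y * z))
      ≡ + 1 * (x * x + y * y + z * z) - + 1 * + 1 * + 1 - + 2 * x * y * z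
  C₁-as-difference = ℤ-Solver.solve-∀

completed-square-in-x : ∀ x y z → (y * z - x) * (y * z - x) - (y * y - + 1) * (z * z - + 1)
                        ≡ (x * x + y * y + z * z) - (+ 1 + + 2 * (x * y * z))
completed-square-in-x = ℤ-Solver.solve-∀

completed-square-in-y : ∀ x y z → (y - x * z) * (y - x * z) - (x * x - + 1) * (z * z - + 1)
                        ≡ (x * x + y * y + z * z) - (+ 1 + + 2 * (x * y * z))
completed-square-in-y = ℤ-Solver.solve-∀

completed-square-in-z : ∀ x y z → (x * y - z) * (x * y - z) - (x * x - + 1) * (y * y - + 1)
                        ≡ (x * x + y * y + z * z) - (+ 1 + + 2 * (x * y * z))
completed-square-in-z = ℤ-Solver.solve-∀

module OnCubic (x y z : ℤ) (cubic : x * x + y * y + z * z ≡ + 1 + + 2 * (x * y * z)) where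

  cubic⇒IsSqrt[yz-x] : x ≤ y * z → IsSqrt (y * z - x) ((y * y - + 1) * (z * z - + 1))
  cubic⇒IsSqrt[yz-x] x≤yz =
    i≤j⇒0≤j-i x≤yz , i-j≡0⇒i≡j _ _ (trans (completed-square-in-x x y z) (i≡j⇒i-j≡0 cubic))

  cubic⇒IsSqrt[y-xz] : x * z ≤ y → IsSqrt (y - x * z) ((x * x - + 1) * (z * z - + 1))
  cubic⇒IsSqrt[y-xz] xz≤y =
    i≤j⇒0≤j-i xz≤y , i-j≡0⇒i≡j _ _ (trans (completed-square-in-y x y z) (i≡j⇒i-j≡0 cubic))

  cubic⇒IsSqrt[xy-z] : z ≤ x * y → IsSqrt (x * y - z) ((x * x - + 1) * (y * y - + 1))
  cubic⇒IsSqrt[xy-z] z≤xy =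
    i≤j⇒0≤j-i z≤xy , i-j≡0⇒i≡j _ _ (trans (completed-square-in-z x y z) (i≡j⇒i-j≡0 cubic))

cubic-from-pos : ∀ a b c → + a * + a + + b * + b + + c * + c ≡ + 1 + + 2 * (+ a * + b * + c) →
  a ℕ.* a ℕ.+ b ℕ.* b ℕ.+ c ℕ.* c ≡ 1 ℕ.+ 2 ℕ.* (a ℕ.* b ℕ.* c)
cubic-from-pos a b c cubic = +-injective (trans sum-of-squares (trans cubic (sym one+twice-product)))
  where
  sum-of-squares : + (a ℕ.* a ℕ.+ b ℕ.* b ℕ.+ c ℕ.* c) ≡ + a * + a + + b * + b + + c * + c
  sum-of-squares = trans (pos-+ _ (c ℕ.* c))
    (cong₂ _+_ (trans (pos-+ (a ℕ.* a) (b ℕ.* b)) (cong₂ _+_ (pos-* a a) (pos-* b b))) (pos-* c c))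
  one+twice-product : + (1 ℕ.+ 2 ℕ.* (a ℕ.* b ℕ.* c)) ≡ + 1 + + 2 * (+ a * + b * + c)
  one+twice-product = trans (pos-+ 1 (2 ℕ.* (a ℕ.* b ℕ.* c)))
    (cong (_+_ (+ 1)) (trans (pos-* 2 (a ℕ.* b ℕ.* c))
      (cong (_*_ (+ 2)) (trans (pos-* (a ℕ.* b) c) (cong (_* + c) (pos-* a b))))))

i≡j+[i-j] : ∀ i j → i ≡ j + (i - j)
i≡j+[i-j] = ℤ-Solver.solve-∀

i≡j-[j-i] : ∀ i j → i ≡ j - (j - i)
i≡j-[j-i] = ℤ-Solver.solve-∀

mainTheorem1 : (a b c : ℤ) → + 0 < a → + 0 < b → + 0 < c →
    C₁ a b c ≡ + 0 →
    a ≤ b → c ≤ b →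
    + 1 < a → + 1 < c →
    (∃[ r ] (IsSqrt r ((a * a - + 1) * (c * c - + 1)) × b ≡ a * c + r))
    × (∃[ r ] (IsSqrt r ((b * b - + 1) * (c * c - + 1)) × a ≡ b * c - r))
    × (∃[ r ] (IsSqrt r ((a * a - + 1) * (b * b - + 1)) × c ≡ a * b - r))
mainTheorem1 -[1+ _ ] _ _ () _ _ _ _ _ _ _
mainTheorem1 (+ _) -[1+ _ ] _ _ () _ _ _ _ _ _
mainTheorem1 (+ _) (+ _) -[1+ _ ] _ _ () _ _ _ _ _
mainTheorem1 (+ a) (+ b) (+ c) _ _ _ C₁≡0 (+≤+ a≤b) (+≤+ c≤b) (+<+ 2≤a) (+<+ 2≤c) =
    (+ b - + a * + c , cubic⇒IsSqrt[y-xz] ac≤b , i≡j+[i-j] (+ b) (+ a * + c))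
  , (+ b * + c - + a , cubic⇒IsSqrt[yz-x] a≤bc , i≡j-[j-i] (+ a) (+ b * + c))
  , (+ a * + b - + c , cubic⇒IsSqrt[xy-z] c≤ab , i≡j-[j-i] (+ c) (+ a * + b))
  where
  cubic : + a * + a + + b * + b + + c * + c ≡ + 1 + + 2 * (+ a * + b * + c)
  cubic = C₁≡0⇒cubic (+ a) (+ b) (+ c) C₁≡0
  open OnCubic (+ a) (+ b) (+ c) cubic
  ac≤b : + a * + c ≤ + b
  ac≤b = subst (_≤ + b) (pos-* a c) (+≤+ (product≤middle 2≤a 2≤c a≤b c≤b (cubic-from-pos a b c cubic)))
  a≤bc : + a ≤ + b * + c
  a≤bc = subst (+ a ≤_) (pos-* b c) (+≤+ (ℕ.≤-trans a≤b (ℕ.m≤m*n b c ⦃ ℕ.>-nonZero (ℕ.m<n⇒0<n 2≤c) ⦄)))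
  c≤ab : + c ≤ + a * + b
  c≤ab = subst (+ c ≤_) (pos-* a b) (+≤+ (ℕ.≤-trans c≤b (ℕ.m≤n*m b a ⦃ ℕ.>-nonZero (ℕ.m<n⇒0<n 2≤a) ⦄)))
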